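{- Let $w=\log_2 3$. For every integer $k\ge 1$, $f(k+1) \le 2^{2^k} + 2^{2^k-w}f(k)$.
   Context: $\mu$ is the morphism on binary words with $\mu(0)=01$, $\mu(1)=10$; $\mu^n$ is its $n$-fold iterate. Words $CS(k)$, $k\ge 0$, are defined recursively: $CS(0)=0$ (the one-letter word). For $k\ge 1$, let $n=2^k$, $m=2^{k-1}$, $X=\mu^n(0)$, $Y=\mu^n(1)$, and write $X=x_0x_1\cdots x_{2^m-1}$, $Y=y_0y_1\cdots y_{2^m-1}$ as concatenations of $2^m$ consecutive blocks of length $2^m$ (each block is $\mu^m(0)$ or $\mu^m(1)$). For $0\le i<2^m-1$ define $cs_i=x_i$ if $i$ is even; if $i$ is odd, $cs_i=x_i$ when $x_i=y_{i+1}$ and $cs_i=CS(k-1)$ otherwise. Then $CS(k)=cs_0cs_1\cdots cs_{2^m-2}$. Define $f(k)=2^{2^k}-|CS(k)|$. -}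

module Defs where

open import Data.Bool using (Bool; true; false; if_then_else_)
open import Data.Nat using (ℕ; zero; suc; _*_; _∸_; _^_; _%_)
import Data.Nat as ℕ
open import Data.List using (List; []; _∷_; concatMap; take; drop; length; upTo)
import Data.List.Properties as LP
import Data.Bool.Properties as BP
open import Data.Integer using (ℤ; +_; _-_)
open import Relation.Nullary using (does)

-- Binary words: lists of Bool, with false = letter 0, true = letter 1.
Word : Set
Word = List Bool

μ-letter : Bool → Word
μ-letter false = false ∷ true ∷ []
μ-letter true  = true ∷ false ∷ []

μ : Word → Word
μ = concatMap μ-letter

μ^ : ℕ → Word → Word
μ^ zero    w = w
μ^ (suc n) w = μ (μ^ n w)

block : ℕ → ℕ → Word → Word
block len i w = take len (drop (i * len) w)

_==_ : Word → Word → Bool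
u == v = does (LP.≡-dec BP._≟_ u v)

isEven : ℕ → Bool
isEven i = does (i % 2 ℕ.≟ 0)

CS : ℕ → Word
CS zero    = false ∷ []
CS (suc j) = concatMap cs (upTo (L ∸ 1))
  where
  n m L : ℕ
  n = 2 ^ suc j
  m = 2 ^ j
  L = 2 ^ m
  X Y : Word
  X = μ^ n (false ∷ [])
  Y = μ^ n (true ∷ [])
  x y : ℕ → Word
  x i = block L i X
  y i = block L i Y
  cs : ℕ → Word
  cs i = if isEven i then x i
         else (if x i == y (suc i) then x i else CS j)

f : ℕ → ℤ
f k = + (2 ^ (2 ^ k)) - + length (CS k)

module Submission where

-- Write L = 2^m with m = 2^k.  CS(k+1) is the concatenation of the words
-- cs_i (i < L - 1), where cs_i is the i-th block of length L of
-- X = μ^{2m}(0), except that an odd index i whose block differs from the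
-- (i+1)-st block of Y = μ^{2m}(1) gets the filler CS(k) instead.  Every
-- block has length L, so  f(k+1) ≤ L + r · f(k),  r the number of filler
-- positions.  Since X = μ^m(t), Y = μ^m(t̄) for the Thue–Morse word
-- t = μ^m(0) of length L, a filler at the odd position i forces t_i = t_{i+1};
-- writing t = μ(s), these are exactly the transitions s_j ≠ s_{j+1} of s.
-- The transition counts T(p) of μ^p(0) satisfy T(p+1) + T(p) = 2^{p+1}, hence
-- 3 T(p) + 1 = 2^{p+1} for odd p; as m is even this gives 3 r < L, and the
-- theorem follows by arithmetic.

open import Defs

module NaturalBounds where

  open import Data.Bool using (Bool; true; false; not; _xor_; _∧_; if_then_else_)
  open import Data.Bool.Properties using (not-involutive)
  import Data.Bool.Properties as BP
  open import Data.Nat using (ℕ; zero; suc; _+_; _*_; _∸_; _^_; _≤_; _<_; z≤n; s≤s)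
  open import Data.Nat.Properties
  open import Data.Nat.Tactic.RingSolver using (solve-∀)
  open import Data.List using (List; []; _∷_; _++_; [_]; concatMap; take; drop; length; map; upTo)
  import Data.List.Properties as LP
  open import Relation.Binary.PropositionalEquality using (_≡_; refl; sym; trans; cong; cong₂; module ≡-Reasoning)
  open import Relation.Nullary.Decidable using (dec-true)

  μ-++ : ∀ u v → μ (u ++ v) ≡ μ u ++ μ v
  μ-++ = LP.concatMap-++ μ-letter

  μ^-[] : ∀ n → μ^ n [] ≡ []
  μ^-[] zero    = refl
  μ^-[] (suc n) = cong μ (μ^-[] n)

  μ^-++ : ∀ n u v → μ^ n (u ++ v) ≡ μ^ n u ++ μ^ n v
  μ^-++ zero    u v = refl
  μ^-++ (suc n) u v = trans (cong μ (μ^-++ n u v)) (μ-++ (μ^ n u) (μ^ n v))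

  μ^-letterwise : ∀ n w → μ^ n w ≡ concatMap (λ b → μ^ n [ b ]) w
  μ^-letterwise n []      = μ^-[] n
  μ^-letterwise n (b ∷ w) = trans (μ^-++ n [ b ] w) (cong (μ^ n [ b ] ++_) (μ^-letterwise n w))

  μ^-+ : ∀ a b w → μ^ (a + b) w ≡ μ^ a (μ^ b w)
  μ^-+ zero    b w = refl
  μ^-+ (suc a) b w = cong μ (μ^-+ a b w)

  μ^-double : ∀ m w → μ^ (2 * m) w ≡ μ^ m (μ^ m w)
  μ^-double m w = trans (cong (λ e → μ^ (m + e) w) (+-identityʳ m)) (μ^-+ m m w)

  μ-not : ∀ w → μ (map not w) ≡ map not (μ w)
  μ-not []          = refl
  μ-not (false ∷ w) = cong (λ z → true ∷ false ∷ z) (μ-not w)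
  μ-not (true ∷ w)  = cong (λ z → false ∷ true ∷ z) (μ-not w)

  μ^-not : ∀ n w → μ^ n (map not w) ≡ map not (μ^ n w)
  μ^-not zero    w = refl
  μ^-not (suc n) w = trans (cong μ (μ^-not n w)) (μ-not (μ^ n w))

  length-μ : ∀ w → length (μ w) ≡ 2 * length w
  length-μ []          = refl
  length-μ (false ∷ w) = trans (cong (2 +_) (length-μ w)) (sym (*-suc 2 (length w)))
  length-μ (true ∷ w)  = trans (cong (2 +_) (length-μ w)) (sym (*-suc 2 (length w)))

  length-μ^ : ∀ n w → length (μ^ n w) ≡ 2 ^ n * length w
  length-μ^ zero    w = sym (+-identityʳ (length w))
  length-μ^ (suc n) w = begin
    length (μ (μ^ n w))      ≡⟨ length-μ (μ^ n w) ⟩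
    2 * length (μ^ n w)      ≡⟨ cong (2 *_) (length-μ^ n w) ⟩
    2 * (2 ^ n * length w)   ≡⟨ *-assoc 2 (2 ^ n) (length w) ⟨
    2 ^ suc n * length w     ∎
    where open ≡-Reasoning

  length-μ^-letter : ∀ n b → length (μ^ n [ b ]) ≡ 2 ^ n
  length-μ^-letter n b = trans (length-μ^ n [ b ]) (*-identityʳ (2 ^ n))

  tm : ℕ → Word
  tm p = μ^ p [ false ]

  length-tm : ∀ p → length (tm p) ≡ 2 ^ p
  length-tm p = length-μ^-letter p false

  -- The i-th letter of a word; positions past the end read as 1.
  letter : Word → ℕ → Bool
  letter []      _       = true
  letter (b ∷ w) zero    = b
  letter (b ∷ w) (suc i) = letter w i

  letter-map-not : ∀ w i → i < length w → letter (map not w) i ≡ not (letter w i)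
  letter-map-not (b ∷ w) zero    _         = refl
  letter-map-not (b ∷ w) (suc i) (s≤s i<w) = letter-map-not w i i<w

  -- Doubling, with the recursion that matches the letter pairs of μ(w).
  double : ℕ → ℕ
  double zero    = zero
  double (suc n) = suc (suc (double n))

  double≡2* : ∀ n → double n ≡ 2 * n
  double≡2* zero    = refl
  double≡2* (suc n) = trans (cong (2 +_) (double≡2* n)) (sym (*-suc 2 n))

  isEven-double : ∀ j → isEven (double j) ≡ true
  isEven-double zero    = refl
  isEven-double (suc j) = isEven-double j

  isEven-suc-double : ∀ j → isEven (suc (double j)) ≡ false
  isEven-suc-double zero    = refl
  isEven-suc-double (suc j) = isEven-suc-double j

  letter-μ-even : ∀ w j → letter (μ w) (double j) ≡ letter w j
  letter-μ-even []          zero    = refl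
  letter-μ-even []          (suc j) = refl
  letter-μ-even (false ∷ w) zero    = refl
  letter-μ-even (true ∷ w)  zero    = refl
  letter-μ-even (false ∷ w) (suc j) = letter-μ-even w j
  letter-μ-even (true ∷ w)  (suc j) = letter-μ-even w j

  letter-μ-odd : ∀ w j → j < length w → letter (μ w) (suc (double j)) ≡ not (letter w j)
  letter-μ-odd (false ∷ w) zero    _         = refl
  letter-μ-odd (true ∷ w)  zero    _         = refl
  letter-μ-odd (false ∷ w) (suc j) (s≤s j<w) = letter-μ-odd w j j<w
  letter-μ-odd (true ∷ w)  (suc j) (s≤s j<w) = letter-μ-odd w j j<w

  take-++-length : ∀ (u v : Word) → take (length u) (u ++ v) ≡ u
  take-++-length []      v = refl
  take-++-length (b ∷ u) v = cong (b ∷_) (take-++-length u v)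

  drop-++-length : ∀ (u v : Word) n → drop (length u + n) (u ++ v) ≡ drop n v
  drop-++-length []      v n = refl
  drop-++-length (b ∷ u) v n = drop-++-length u v n

  block-concatMap : ∀ (g : Bool → Word) n → (∀ b → length (g b) ≡ n) →
    ∀ w i → i < length w → block n i (concatMap g w) ≡ g (letter w i)
  block-concatMap g n g-len (b ∷ w) zero _ = begin
    take n (g b ++ concatMap g w)              ≡⟨ cong (λ e → take e (g b ++ concatMap g w)) (g-len b) ⟨
    take (length (g b)) (g b ++ concatMap g w) ≡⟨ take-++-length (g b) (concatMap g w) ⟩
    g b                                        ∎
    where open ≡-Reasoning
  block-concatMap g n g-len (b ∷ w) (suc i) (s≤s i<w) = begin
    take n (drop (n + i * n) (g b ++ concatMap g w))
      ≡⟨ cong (λ e → take n (drop (e + i * n) (g b ++ concatMap g w))) (g-len b) ⟨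
    take n (drop (length (g b) + i * n) (g b ++ concatMap g w))
      ≡⟨ cong (take n) (drop-++-length (g b) (concatMap g w) (i * n)) ⟩
    block n i (concatMap g w)
      ≡⟨ block-concatMap g n g-len w i i<w ⟩
    g (letter w i) ∎
    where open ≡-Reasoning

  blockX blockY : ℕ → ℕ → Word
  blockX m i = block (2 ^ m) i (μ^ (2 * m) [ false ])
  blockY m i = block (2 ^ m) i (μ^ (2 * m) [ true ])

  blockX-letter : ∀ m i → i < 2 ^ m → blockX m i ≡ μ^ m [ letter (tm m) i ]
  blockX-letter m i i<L = begin
    block (2 ^ m) i (μ^ (2 * m) [ false ])
      ≡⟨ cong (block (2 ^ m) i) (trans (μ^-double m [ false ]) (μ^-letterwise m (tm m))) ⟩
    block (2 ^ m) i (concatMap (λ b → μ^ m [ b ]) (tm m))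
      ≡⟨ block-concatMap _ (2 ^ m) (length-μ^-letter m) (tm m) i
           (≤-trans i<L (≤-reflexive (sym (length-tm m)))) ⟩
    μ^ m [ letter (tm m) i ] ∎
    where open ≡-Reasoning

  blockY-letter : ∀ m i → i < 2 ^ m → blockY m i ≡ μ^ m [ not (letter (tm m) i) ]
  blockY-letter m i i<L = begin
    block (2 ^ m) i (μ^ (2 * m) [ true ])
      ≡⟨ cong (block (2 ^ m) i) (trans (μ^-double m [ true ])
           (trans (cong (μ^ m) (μ^-not m [ false ])) (μ^-letterwise m (map not (tm m))))) ⟩
    block (2 ^ m) i (concatMap (λ b → μ^ m [ b ]) (map not (tm m)))
      ≡⟨ block-concatMap _ (2 ^ m) (length-μ^-letter m) (map not (tm m)) i
           (≤-trans i<L (≤-reflexive (sym (trans (LP.length-map not (tm m)) (length-tm m))))) ⟩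
    μ^ m [ letter (map not (tm m)) i ]
      ≡⟨ cong (λ b → μ^ m [ b ]) (letter-map-not (tm m) i i<t) ⟩
    μ^ m [ not (letter (tm m) i) ] ∎
    where
    open ≡-Reasoning
    i<t : i < length (tm m)
    i<t = ≤-trans i<L (≤-reflexive (sym (length-tm m)))

  length-blockX : ∀ m i → i < 2 ^ m → length (blockX m i) ≡ 2 ^ m
  length-blockX m i i<L = trans (cong length (blockX-letter m i i<L)) (length-μ^-letter m _)

  length-blockX-≤ : ∀ m i → length (blockX m i) ≤ 2 ^ m
  length-blockX-≤ m i = ≤-trans (≤-reflexive (LP.length-take (2 ^ m) _)) (m⊓n≤m (2 ^ m) _)

  ind : Bool → ℕ
  ind true  = 1
  ind false = 0

  count : (ℕ → Bool) → ℕ → ℕ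
  count P zero    = 0
  count P (suc n) = ind (P n) + count P n

  count-cong : ∀ P Q n → (∀ i → i < n → P i ≡ Q i) → count P n ≡ count Q n
  count-cong P Q zero    _   = refl
  count-cong P Q (suc n) P≡Q =
    cong₂ _+_ (cong ind (P≡Q n ≤-refl)) (count-cong P Q n (λ i i<n → P≡Q i (m≤n⇒m≤1+n i<n)))

  count-const : ∀ b n → count (λ _ → b) n ≡ ind b * n
  count-const b zero    = sym (*-zeroʳ (ind b))
  count-const b (suc n) = trans (cong (ind b +_) (count-const b n)) (sym (*-suc (ind b) n))

  ind-mono : ∀ {a b} → (a ≡ true → b ≡ true) → ind a ≤ ind b
  ind-mono {false} _   = z≤n
  ind-mono {true}  a⇒b rewrite a⇒b refl = ≤-refl

  count-mono : ∀ P Q n → (∀ i → i < n → P i ≡ true → Q i ≡ true) → count P n ≤ count Q n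
  count-mono P Q zero    _   = z≤n
  count-mono P Q (suc n) P⇒Q =
    +-mono-≤ (ind-mono (P⇒Q n ≤-refl)) (count-mono P Q n (λ i i<n → P⇒Q i (m≤n⇒m≤1+n i<n)))

  count-pred : ∀ P n → count P (n ∸ 1) ≤ count P n
  count-pred P zero    = z≤n
  count-pred P (suc n) = m≤n+m (count P n) (ind (P n))

  count-complement : ∀ P n → count P n + count (λ i → not (P i)) n ≡ n
  count-complement P zero    = refl
  count-complement P (suc n) = begin
    (ind (P n) + A) + (ind (not (P n)) + B) ≡⟨ shuffle (ind (P n)) A (ind (not (P n))) B ⟩
    (ind (P n) + ind (not (P n))) + (A + B) ≡⟨ cong₂ _+_ (ind-not (P n)) (count-complement P n) ⟩
    suc n                                   ∎
    where
    open ≡-Reasoning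
    A = count P n
    B = count (λ i → not (P i)) n
    ind-not : ∀ b → ind b + ind (not b) ≡ 1
    ind-not true  = refl
    ind-not false = refl
    shuffle : ∀ x a y b → (x + a) + (y + b) ≡ (x + y) + (a + b)
    shuffle = solve-∀

  count-double : ∀ P a →
    count P (double a) ≡ count (λ j → P (double j)) a + count (λ j → P (suc (double j))) a
  count-double P zero    = refl
  count-double P (suc a) = begin
    ind (P (suc (double a))) + (ind (P (double a)) + count P (double a))
      ≡⟨ cong (λ z → ind (P (suc (double a))) + (ind (P (double a)) + z)) (count-double P a) ⟩
    ind (P (suc (double a))) + (ind (P (double a)) + (E + O))
      ≡⟨ shuffle (ind (P (suc (double a)))) (ind (P (double a))) E O ⟩
    (ind (P (double a)) + E) + (ind (P (suc (double a))) + O) ∎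
    where
    open ≡-Reasoning
    E = count (λ j → P (double j)) a
    O = count (λ j → P (suc (double j))) a
    shuffle : ∀ x y a b → x + (y + (a + b)) ≡ (y + a) + (x + b)
    shuffle = solve-∀

  change : Word → ℕ → Bool
  change s i = letter s i xor letter s (suc i)

  not-xor : ∀ a b → not a xor b ≡ not (a xor b)
  not-xor true  b = sym (not-involutive b)
  not-xor false b = refl

  change-μ-even : ∀ s j → j < length s → change (μ s) (double j) ≡ true
  change-μ-even s j j<s =
    trans (cong₂ _xor_ (letter-μ-even s j) (letter-μ-odd s j j<s)) (xor-not (letter s j))
    where
    xor-not : ∀ a → a xor not a ≡ true
    xor-not true  = refl
    xor-not false = refl

  change-μ-odd : ∀ s j → j < length s → change (μ s) (suc (double j)) ≡ not (change s j)
  change-μ-odd s j j<s =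
    trans (cong₂ _xor_ (letter-μ-odd s j j<s) (letter-μ-even s (suc j)))
          (not-xor (letter s j) (letter s (suc j)))

  count-change-μ : ∀ s a → a ≤ length s →
    count (change (μ s)) (double a) + count (change s) a ≡ double a
  count-change-μ s a a≤s = begin
    count (change (μ s)) (double a) + C
      ≡⟨ cong (_+ C) (count-double (change (μ s)) a) ⟩
    (count (λ j → change (μ s) (double j)) a + count (λ j → change (μ s) (suc (double j))) a) + C
      ≡⟨ cong₂ (λ u v → (u + v) + C) evens odds ⟩
    (a + count (λ j → not (change s j)) a) + C
      ≡⟨ +-assoc a _ C ⟩
    a + (count (λ j → not (change s j)) a + C)
      ≡⟨ cong (a +_) (trans (+-comm _ C) (count-complement (change s) a)) ⟩
    a + a
      ≡⟨ trans (cong (a +_) (sym (+-identityʳ a))) (sym (double≡2* a)) ⟩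
    double a ∎
    where
    open ≡-Reasoning
    C = count (change s) a
    evens : count (λ j → change (μ s) (double j)) a ≡ a
    evens = trans (count-cong _ _ a (λ j j<a → change-μ-even s j (<-≤-trans j<a a≤s)))
                  (trans (count-const true a) (*-identityˡ a))
    odds : count (λ j → change (μ s) (suc (double j))) a ≡ count (λ j → not (change s j)) a
    odds = count-cong _ _ a (λ j j<a → change-μ-odd s j (<-≤-trans j<a a≤s))

  transitions : ℕ → ℕ
  transitions p = count (change (tm p)) (2 ^ p)

  2^suc≡double : ∀ p → 2 ^ suc p ≡ double (2 ^ p)
  2^suc≡double p = sym (double≡2* (2 ^ p))

  transitions-step : ∀ p → transitions (suc p) + transitions p ≡ 2 ^ suc p
  transitions-step p = begin
    count (change (μ (tm p))) (2 ^ suc p) + transitions p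
      ≡⟨ cong (λ z → count (change (μ (tm p))) z + transitions p) (2^suc≡double p) ⟩
    count (change (μ (tm p))) (double (2 ^ p)) + transitions p
      ≡⟨ count-change-μ (tm p) (2 ^ p) (≤-reflexive (sym (length-tm p))) ⟩
    double (2 ^ p)
      ≡⟨ 2^suc≡double p ⟨
    2 ^ suc p ∎
    where open ≡-Reasoning

  transitions-step₂ : ∀ p → transitions (suc (suc p)) ≡ 2 ^ suc p + transitions p
  transitions-step₂ p = +-cancelʳ-≡ (transitions (suc p)) _ _ (begin
    transitions (suc (suc p)) + transitions (suc p) ≡⟨ transitions-step (suc p) ⟩
    2 ^ suc (suc p)                                 ≡⟨ cong (P +_) (+-identityʳ P) ⟩
    P + P                                           ≡⟨ cong (P +_) (transitions-step p) ⟨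
    P + (transitions (suc p) + transitions p)       ≡⟨ regroup P (transitions (suc p)) (transitions p) ⟩
    (P + transitions p) + transitions (suc p)       ∎)
    where
    open ≡-Reasoning
    P = 2 ^ suc p
    regroup : ∀ x y z → x + (y + z) ≡ (x + z) + y
    regroup = solve-∀

  transitions-odd : ∀ q → 3 * transitions (suc (double q)) + 1 ≡ 2 ^ suc (suc (double q))
  transitions-odd zero    = refl
  transitions-odd (suc q) = begin
    3 * transitions (suc (suc p)) + 1   ≡⟨ cong (λ z → 3 * z + 1) (transitions-step₂ p) ⟩
    3 * (P + transitions p) + 1         ≡⟨ expand P (transitions p) ⟩
    3 * P + (3 * transitions p + 1)     ≡⟨ cong (3 * P +_) (transitions-odd q) ⟩
    3 * P + P                           ≡⟨ quadruple P ⟩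
    2 ^ suc (suc (suc p))               ∎
    where
    open ≡-Reasoning
    p = suc (double q)
    P = 2 ^ suc p
    expand : ∀ x y → 3 * (x + y) + 1 ≡ 3 * x + (3 * y + 1)
    expand = solve-∀
    quadruple : ∀ x → 3 * x + x ≡ 2 * (2 * x)
    quadruple = solve-∀

  oddPlateau : Word → ℕ → Bool
  oddPlateau s i = not (isEven i) ∧ not (change s i)

  count-oddPlateau-μ : ∀ s a → a ≤ length s → count (oddPlateau (μ s)) (double a) ≡ count (change s) a
  count-oddPlateau-μ s a a≤s = begin
    count (oddPlateau (μ s)) (double a)
      ≡⟨ count-double (oddPlateau (μ s)) a ⟩
    count (λ j → oddPlateau (μ s) (double j)) a + count (λ j → oddPlateau (μ s) (suc (double j))) a
      ≡⟨ cong₂ _+_ evens odds ⟩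
    0 + count (change s) a ∎
    where
    open ≡-Reasoning
    evens : count (λ j → oddPlateau (μ s) (double j)) a ≡ 0
    evens = trans (count-cong _ _ a (λ j _ → cong (λ e → not e ∧ not (change (μ s) (double j))) (isEven-double j)))
                  (count-const false a)
    odd-entry : ∀ j → j < a → oddPlateau (μ s) (suc (double j)) ≡ change s j
    odd-entry j j<a = begin
      not (isEven (suc (double j))) ∧ not (change (μ s) (suc (double j)))
        ≡⟨ cong₂ (λ e c → not e ∧ not c) (isEven-suc-double j) (change-μ-odd s j (<-≤-trans j<a a≤s)) ⟩
      not (not (change s j))
        ≡⟨ not-involutive (change s j) ⟩
      change s j ∎
    odds : count (λ j → oddPlateau (μ s) (suc (double j))) a ≡ count (change s) a
    odds = count-cong _ _ a odd-entry

  length-concatMap-upTo-suc : ∀ (g : ℕ → Word) N →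
    length (concatMap g (upTo (suc N))) ≡ length (concatMap g (upTo N)) + length (g N)
  length-concatMap-upTo-suc g N = begin
    length (concatMap g (upTo (suc N)))
      ≡⟨ cong (λ z → length (concatMap g z)) (LP.upTo-∷ʳ N) ⟨
    length (concatMap g (upTo N ++ [ N ]))
      ≡⟨ cong length (LP.concatMap-++ g (upTo N) [ N ]) ⟩
    length (concatMap g (upTo N) ++ (g N ++ []))
      ≡⟨ LP.length-++ (concatMap g (upTo N)) ⟩
    length (concatMap g (upTo N)) + length (g N ++ [])
      ≡⟨ cong (λ z → length (concatMap g (upTo N)) + length z) (LP.++-identityʳ (g N)) ⟩
    length (concatMap g (upTo N)) + length (g N) ∎
    where open ≡-Reasoning

  length-concatMap-≤ : ∀ (g : ℕ → Word) L → (∀ i → length (g i) ≤ L) →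
    ∀ N → length (concatMap g (upTo N)) ≤ N * L
  length-concatMap-≤ g L g≤ zero    = z≤n
  length-concatMap-≤ g L g≤ (suc N) = begin
    length (concatMap g (upTo (suc N)))          ≡⟨ length-concatMap-upTo-suc g N ⟩
    length (concatMap g (upTo N)) + length (g N) ≤⟨ +-mono-≤ (length-concatMap-≤ g L g≤ N) (g≤ N) ⟩
    N * L + L                                    ≡⟨ +-comm (N * L) L ⟩
    suc N * L                                    ∎
    where open ≤-Reasoning

  length-concatMap-≥ : ∀ (g : ℕ → Word) (short : ℕ → Bool) L d N →
    (∀ i → i < N → L ≤ length (g i) + ind (short i) * d) →
    N * L ≤ length (concatMap g (upTo N)) + d * count short N
  length-concatMap-≥ g short L d zero    _  = z≤n
  length-concatMap-≥ g short L d (suc N) g≥ = begin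
    L + N * L
      ≤⟨ +-mono-≤ (g≥ N ≤-refl) (length-concatMap-≥ g short L d N (λ i i<N → g≥ i (m≤n⇒m≤1+n i<N))) ⟩
    (length (g N) + ind (short N) * d) + (length (concatMap g (upTo N)) + d * count short N)
      ≡⟨ regroup (length (g N)) (ind (short N)) d (length (concatMap g (upTo N))) (count short N) ⟩
    (length (concatMap g (upTo N)) + length (g N)) + d * (ind (short N) + count short N)
      ≡⟨ cong (_+ d * count short (suc N)) (length-concatMap-upTo-suc g N) ⟨
    length (concatMap g (upTo (suc N))) + d * count short (suc N) ∎
    where
    open ≤-Reasoning
    regroup : ∀ a b d A C → (a + b * d) + (A + d * C) ≡ (A + a) + d * (b + C)
    regroup = solve-∀

  piece : ℕ → Word → ℕ → Word
  piece m w i = if isEven i then blockX m i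
                else (if blockX m i == blockY m (suc i) then blockX m i else w)

  glue : ℕ → Word → Word
  glue m w = concatMap (piece m w) (upTo (2 ^ m ∸ 1))

  mismatch : ℕ → ℕ → Bool
  mismatch m i = not (isEven i) ∧ not (blockX m i == blockY m (suc i))

  CS-suc : ∀ j → CS (suc j) ≡ glue (2 ^ j) (CS j)
  CS-suc j = refl

  length-piece-≤ : ∀ m w i → length w ≤ 2 ^ m → length (piece m w i) ≤ 2 ^ m
  length-piece-≤ m w i w≤L with isEven i | blockX m i == blockY m (suc i)
  ... | true  | _     = length-blockX-≤ m i
  ... | false | true  = length-blockX-≤ m i
  ... | false | false = w≤L

  length-piece-≥ : ∀ m w i → length w ≤ 2 ^ m → i < 2 ^ m →
    2 ^ m ≤ length (piece m w i) + ind (mismatch m i) * (2 ^ m ∸ length w)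
  length-piece-≥ m w i w≤L i<L with isEven i | blockX m i == blockY m (suc i)
  ... | true  | _     = ≤-trans (≤-reflexive (sym (length-blockX m i i<L))) (m≤m+n _ _)
  ... | false | true  = ≤-trans (≤-reflexive (sym (length-blockX m i i<L))) (m≤m+n _ _)
  ... | false | false =
    ≤-reflexive (sym (trans (cong (length w +_) (+-identityʳ _)) (m+[n∸m]≡n w≤L)))

  glue-≤ : ∀ m w → length w ≤ 2 ^ m → length (glue m w) ≤ (2 ^ m ∸ 1) * 2 ^ m
  glue-≤ m w w≤L = length-concatMap-≤ (piece m w) (2 ^ m) (λ i → length-piece-≤ m w i w≤L) (2 ^ m ∸ 1)

  glue-≥ : ∀ m w → length w ≤ 2 ^ m →
    (2 ^ m ∸ 1) * 2 ^ m ≤ length (glue m w) + (2 ^ m ∸ length w) * count (mismatch m) (2 ^ m ∸ 1)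
  glue-≥ m w w≤L = length-concatMap-≥ (piece m w) (mismatch m) (2 ^ m) (2 ^ m ∸ length w) (2 ^ m ∸ 1)
    (λ i i<L-1 → length-piece-≥ m w i w≤L (<-≤-trans i<L-1 (m∸n≤m (2 ^ m) 1)))

  -- A mismatch at the odd position i forces t_i = t_{i+1} in t = tm m:
  -- otherwise t_i = ¬t_{i+1} and the two blocks coincide.
  mismatch⇒oddPlateau : ∀ m i → suc i < 2 ^ m → mismatch m i ≡ true → oddPlateau (tm m) i ≡ true
  mismatch⇒oddPlateau m i si<L mis with isEven i | change (tm m) i in chg
  ... | true  | _     = mis
  ... | false | false = refl
  ... | false | true  = trans (cong not (sym blocks-agree)) mis
    where
    xor≡true : ∀ a b → a xor b ≡ true → a ≡ not b
    xor≡true true  false _ = refl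
    xor≡true false true  _ = refl
    blocks-agree : (blockX m i == blockY m (suc i)) ≡ true
    blocks-agree = dec-true (LP.≡-dec BP._≟_ (blockX m i) (blockY m (suc i))) (begin
      blockX m i                                 ≡⟨ blockX-letter m i (<-trans (n<1+n i) si<L) ⟩
      μ^ m [ letter (tm m) i ]                   ≡⟨ cong (λ b → μ^ m [ b ]) (xor≡true _ _ chg) ⟩
      μ^ m [ not (letter (tm m) (suc i)) ]       ≡⟨ blockY-letter m (suc i) si<L ⟨
      blockY m (suc i)                           ∎)
      where open ≡-Reasoning

  count-mismatch-≤ : ∀ p → count (mismatch (suc p)) (2 ^ suc p ∸ 1) ≤ transitions p
  count-mismatch-≤ p = begin
    count (mismatch (suc p)) (2 ^ suc p ∸ 1)
      ≤⟨ count-mono _ _ _ (λ i i<L-1 → mismatch⇒oddPlateau (suc p) i (<∸1⇒suc< (2 ^ suc p) i<L-1)) ⟩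
    count (oddPlateau (μ (tm p))) (2 ^ suc p ∸ 1)
      ≤⟨ count-pred _ (2 ^ suc p) ⟩
    count (oddPlateau (μ (tm p))) (2 ^ suc p)
      ≡⟨ cong (count (oddPlateau (μ (tm p)))) (2^suc≡double p) ⟩
    count (oddPlateau (μ (tm p))) (double (2 ^ p))
      ≡⟨ count-oddPlateau-μ (tm p) (2 ^ p) (≤-reflexive (sym (length-tm p))) ⟩
    transitions p ∎
    where
    open ≤-Reasoning
    <∸1⇒suc< : ∀ {i} n → i < n ∸ 1 → suc i < n
    <∸1⇒suc< (suc n) i<n = s≤s i<n

  count-mismatch-third : ∀ q → 3 * count (mismatch (double (suc q))) (2 ^ double (suc q) ∸ 1) + 1 ≤ 2 ^ double (suc q)
  count-mismatch-third q =
    ≤-trans (+-monoˡ-≤ 1 (*-monoʳ-≤ 3 (count-mismatch-≤ (suc (double q)))))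
            (≤-reflexive (transitions-odd q))

  2^2*≡ : ∀ m → 2 ^ (2 * m) ≡ 2 ^ m * 2 ^ m
  2^2*≡ m = trans (cong (λ e → 2 ^ (m + e)) (+-identityʳ m)) (^-distribˡ-+-* 2 m m)

  length-CS-≤ : ∀ j → length (CS j) ≤ 2 ^ (2 ^ j)
  length-CS-≤ zero    = s≤s z≤n
  length-CS-≤ (suc j) = begin
    length (CS (suc j))    ≡⟨ cong length (CS-suc j) ⟩
    length (glue m (CS j)) ≤⟨ glue-≤ m (CS j) (length-CS-≤ j) ⟩
    (2 ^ m ∸ 1) * 2 ^ m   ≤⟨ *-monoˡ-≤ (2 ^ m) (m∸n≤m (2 ^ m) 1) ⟩
    2 ^ m * 2 ^ m         ≡⟨ 2^2*≡ m ⟨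
    2 ^ (2 * m)           ∎
    where
    open ≤-Reasoning
    m = 2 ^ j

  defect-arith : ∀ L C d r → 1 ≤ L → (L ∸ 1) * L ≤ C + d * r → 3 * r ≤ L →
    3 * (L * L ∸ C) ≤ 3 * L + L * d
  defect-arith (suc L) C d r _ low 3r≤ = begin
    3 * (suc L * suc L ∸ C)  ≤⟨ *-monoʳ-≤ 3 (m≤n+o⇒m∸n≤o (suc L * suc L) C square≤) ⟩
    3 * (d * r + suc L)      ≡⟨ expand d r (suc L) ⟩
    d * (3 * r) + 3 * suc L  ≤⟨ +-monoˡ-≤ (3 * suc L) (*-monoʳ-≤ d 3r≤) ⟩
    d * suc L + 3 * suc L    ≡⟨ swap d (suc L) ⟩
    3 * suc L + suc L * d    ∎
    where
    open ≤-Reasoning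
    expand : ∀ d r L → 3 * (d * r + L) ≡ d * (3 * r) + 3 * L
    expand = solve-∀
    swap : ∀ d L → d * L + 3 * L ≡ 3 * L + L * d
    swap = solve-∀
    square≤ : suc L * suc L ≤ C + (d * r + suc L)
    square≤ = ≤-trans (≤-reflexive (+-comm (suc L) (L * suc L)))
      (≤-trans (+-monoˡ-≤ (suc L) low) (≤-reflexive (+-assoc C (d * r) (suc L))))

  glue-defect : ∀ m q w → m ≡ double (suc q) → length w ≤ 2 ^ m →
    3 * (2 ^ (2 * m) ∸ length (glue m w)) ≤ 3 * 2 ^ m + 2 ^ m * (2 ^ m ∸ length w)
  glue-defect .(double (suc q)) q w refl w≤L = begin
    3 * (2 ^ (2 * m) ∸ length (glue m w)) ≡⟨ cong (λ z → 3 * (z ∸ length (glue m w))) (2^2*≡ m) ⟩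
    3 * (2 ^ m * 2 ^ m ∸ length (glue m w))
      ≤⟨ defect-arith (2 ^ m) (length (glue m w)) (2 ^ m ∸ length w) (count (mismatch m) (2 ^ m ∸ 1))
           (m^n>0 2 m) (glue-≥ m w w≤L) (≤-trans (m≤m+n _ 1) (count-mismatch-third q)) ⟩
    3 * 2 ^ m + 2 ^ m * (2 ^ m ∸ length w) ∎
    where
    open ≤-Reasoning
    m = double (suc q)

open NaturalBounds using (double; double≡2*; length-CS-≤; glue-defect)
open import Data.Nat using (ℕ; suc; _^_)
import Data.Nat as ℕ
import Data.Nat.Properties as ℕP
open import Data.Integer using (+_; _+_; _*_; _≤_; +≤+)
open import Data.Integer.Properties using (m-n≡m⊖n; ⊖-≥; pos-+; pos-*; module ≤-Reasoning)
open import Data.List using (length)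
open import Relation.Binary.PropositionalEquality using (_≡_; sym; trans; cong; cong₂)

f≡ : ∀ k → f k ≡ + (2 ^ (2 ^ k) ℕ.∸ length (CS k))
f≡ k = trans (m-n≡m⊖n (2 ^ (2 ^ k)) (length (CS k))) (⊖-≥ (length-CS-≤ k))

corollary4 : (k : ℕ) → 1 ℕ.≤ k →
    + 3 * f (suc k) ≤ + 3 * + (2 ^ (2 ^ k)) + + (2 ^ (2 ^ k)) * f k
corollary4 (suc j) _ = begin
  + 3 * f (suc k)                 ≡⟨ cong (+ 3 *_) (f≡ (suc k)) ⟩
  + 3 * + (2 ^ (2 ℕ.* m) ℕ.∸ C)   ≡⟨ pos-* 3 (2 ^ (2 ℕ.* m) ℕ.∸ C) ⟨
  + (3 ℕ.* (2 ^ (2 ℕ.* m) ℕ.∸ C)) ≤⟨ +≤+ (glue-defect m q (CS k) m≡ (length-CS-≤ k)) ⟩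
  + (3 ℕ.* L ℕ.+ L ℕ.* d)         ≡⟨ trans (pos-+ (3 ℕ.* L) (L ℕ.* d)) (cong₂ _+_ (pos-* 3 L) (pos-* L d)) ⟩
  + 3 * + L + + L * + d           ≡⟨ cong (λ z → + 3 * + L + + L * z) (f≡ k) ⟨
  + 3 * + L + + L * f k           ∎
  where
  open ≤-Reasoning
  k = suc j
  m = 2 ^ k
  L = 2 ^ m
  C = length (CS (suc k))
  d = L ℕ.∸ length (CS k)
  q = ℕ.pred (2 ^ j)
  m≡ : m ≡ double (suc q)
  m≡ = trans (cong (2 ℕ.*_) (sym (ℕP.suc-pred (2 ^ j) {{ℕ.>-nonZero (ℕP.m^n>0 2 j)}})))
             (sym (double≡2* (suc q)))
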